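{- Let $V$ be a finite set of $n\ge1$ vertices with a metric $d$, let $k\ge1$ and $0\le q<n$ be integers, and assume $NR_q(i)>0$ for all $i\in V$. Let $(S,O,\sigma)$ be the output of the following procedure (Algorithm 2): start with $P:=V$, $S:=\emptyset$; while $P\neq\emptyset$ and $|S|<k$, choose $s\in P$ with $s\in\arg\min_{i\in P} NR_q(i)$ (ties arbitrary), set $S:=S\cup\{s\}$ and $P:=\{i\in P: d_{is}>2\,NR_q(i)\}$; finally set $O:=P$ and $\sigma(i)\in\arg\min_{h\in S}d_{ih}$ for each $i\in V\setminus O$. Then $(S,O,\sigma)$ is a feasible solution of the IF$k$CO instance $(V,d,k,q)$ and $\alpha(S,O,\sigma)\le 4\cdot OPT$, i.e. Algorithm 2 is a $4$-approximation algorithm for the IF$k$CO.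
   Context: A metric $d$ on $V$ satisfies $d_{ij}\ge0$, $d_{ii}=0$, $d_{ij}=d_{ji}$ and $d_{hi}+d_{ij}\ge d_{hj}$. For $i\in V$, $NR_q(i)$ is the distance from $i$ to its $\lceil (n-q)/k\rceil$-th nearest neighbour in $V$ ($i$ counts as its own first nearest neighbour). In the individually fair $k$-center with outliers (IF$k$CO), a solution is a triple $(S,O,\sigma)$ with $S\subseteq V$ (centers), $O\subseteq V$ (outliers), $\sigma:V\setminus O\to S$; it is feasible if $|S|\le k$ and $|O|\le q$. Its outlier-related fairness ratio is $\alpha(S,O,\sigma)=\max_{i\in V\setminus O} d_{\sigma(i)i}/NR_q(i)$, and $OPT$ is the minimum of $\alpha$ over all feasible solutions.
   Formalization: The distances $d_{ij}$ of the metric take rational values. -}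

module Defs where

open import Data.Nat using (ℕ; zero; suc; _∸_)
import Data.Nat as ℕ
open import Data.Fin using (Fin)
open import Data.Fin.Subset using (Subset; _∈_; _∉_; ∣_∣; inside; outside; _∪_; ⁅_⁆)
open import Data.Fin.Subset.Properties using (_∈?_)
open import Data.Vec using (tabulate; lookup)
open import Data.List using (List; []; _∷_; map; foldr)
open import Data.List.Base using (allFin)
open import Data.Rational using (ℚ; 0ℚ; _≤_; _<_; _+_; _*_; _÷_; _⊔_; ≢-nonZero)
open import Data.Rational.Properties using (≤-decTotalOrder; _≟_; _<?_)
open import Data.Product using (_×_)
open import Data.Sum using (_⊎_)
open import Relation.Binary.PropositionalEquality using (_≡_)
open import Data.Bool using (Bool; true; false; _∧_; if_then_else_)
open import Relation.Nullary using (yes; no; does)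
import Data.List.Sort

open Data.List.Sort ≤-decTotalOrder using (sort)

record IsMetric {n : ℕ} (d : Fin n → Fin n → ℚ) : Set where
  field
    nonneg : ∀ i j → 0ℚ ≤ d i j
    refl0  : ∀ i → d i i ≡ 0ℚ
    symm   : ∀ i j → d i j ≡ d j i
    tri    : ∀ h i j → d h j ≤ d h i + d i j

-- ⌈ a / k ⌉ (only used with k ≥ 1).
ceilDiv : ℕ → ℕ → ℕ
ceilDiv a zero    = 0
ceilDiv a (suc k) = ℕ._/_ (a ℕ.+ k) (suc k)

-- m-th element (1-indexed) of a list; 0 if out of range (never happens below).
nth1 : ℕ → List ℚ → ℚ
nth1 _             []       = 0ℚ
nth1 zero          (x ∷ xs) = 0ℚ
nth1 (suc zero)    (x ∷ xs) = x
nth1 (suc (suc m)) (x ∷ xs) = nth1 (suc m) xs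

-- NR_q(i): distance from i to its ⌈(n-q)/k⌉-th nearest neighbour in V
-- (i counts as its own first nearest neighbour): the ⌈(n-q)/k⌉-th smallest
-- element of the multiset { d i j | j ∈ V }.
NR : (n k q : ℕ) → (Fin n → Fin n → ℚ) → Fin n → ℚ
NR n k q d i = nth1 (ceilDiv (n ∸ q) k) (sort (map (d i) (allFin n)))

-- x / y in ℚ, with the (unused) convention x / 0 = 0.
safeDiv : ℚ → ℚ → ℚ
safeDiv x y with y ≟ 0ℚ
... | yes _  = 0ℚ
... | no y≢0 = _÷_ x y {{≢-nonZero y≢0}}

-- A solution (S, O, σ): σ is a total function, only its values on V ∖ O matter.
record Solution (n : ℕ) : Set where
  constructor sol
  field
    S : Subset n
    O : Subset n
    σ : Fin n → Fin n

Feasible : (n k q : ℕ) → Solution n → Set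
Feasible n k q (sol S O σ) =
  (∣ S ∣ ℕ.≤ k) × (∣ O ∣ ℕ.≤ q) × (∀ i → i ∉ O → σ i ∈ S)

-- α(S,O,σ) = max_{i ∈ V∖O} d_{σ(i) i} / NR_q(i)  (max over an empty set = 0;
-- all ratios are ≥ 0, so this is the maximum whenever V∖O ≠ ∅).
alpha : (n k q : ℕ) → (Fin n → Fin n → ℚ) → Solution n → ℚ
alpha n k q d (sol S O σ) =
  foldr _⊔_ 0ℚ (map ratio (allFin n))
  where
  ratio : Fin n → ℚ
  ratio i with i ∈? O
  ... | yes _ = 0ℚ
  ... | no  _ = safeDiv (d (σ i) i) (NR n k q d i)

-- Algorithm 2 as a (nondeterministic) relation.
-- AlgRun n k q d P S P' S' : starting the while-loop in state (P, S), the loop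
-- can terminate in state (P', S'), with arbitrary tie-breaking.
data AlgRun (n k q : ℕ) (d : Fin n → Fin n → ℚ)
     : Subset n → Subset n → Subset n → Subset n → Set where
  stop : ∀ {P S} →
         (∀ i → i ∉ P) ⊎ (k ℕ.≤ ∣ S ∣) →
         AlgRun n k q d P S P S
  step : ∀ {P S Pf Sf} (s : Fin n) →
         s ∈ P →
         (∀ i → i ∈ P → NR n k q d s ≤ NR n k q d i) →
         ∣ S ∣ ℕ.< k →
         AlgRun n k q d
           (tabulate λ i → if does (i ∈? P) ∧ does ((NR n k q d i + NR n k q d i) <? d i s)
                           then inside else outside)
           (S ∪ ⁅ s ⁆)
           Pf Sf →
         AlgRun n k q d P S Pf Sf

{-# OPTIONS --safe #-}
module Submission where

-- Let m = ⌈(n − q)/k⌉, so that every ball B(i, NR_q(i)) contains at least m points.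
--
-- Each centre s chosen by Algorithm 2 minimises NR_q over the remaining points P,
-- so its ball B(s, NR_q(s)) is disjoint from the balls of the earlier centres and
-- from every point that survives it. If the loop stops with k centres, these k
-- disjoint balls contain at least m k ≥ n − q non-outliers, so |O| ≤ q. A point
-- leaves P only when it is within 2 NR_q(i) of a centre, so the output has α ≤ 2.
--
-- Conversely, in any feasible solution at least n − q > (m − 1) k points are served
-- by at most k centres, so some centre c serves a set F of at least m points. For
-- the point i of F farthest from c, the ball B(i, 2 d(c,i)) contains F, hence
-- NR_q(i) ≤ 2 d(c,i) and that solution has α ≥ 1/2. Therefore α ≤ 2 ≤ 4 OPT.

module Counting where
  open import Data.Nat using (ℕ; zero; suc; _+_; _*_; _≤_; _<_; z≤n)
  open import Data.Nat.Properties hiding (_≟_)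
  open import Data.Bool using (if_then_else_)
  open import Data.Fin using (Fin; zero; suc; _≟_)
  open import Data.Fin.Properties using (any?)
  open import Data.Fin.Subset using (Subset; _∈_; _∉_; _∪_; _∩_; ⁅_⁆; ∣_∣; inside; outside; Empty; Nonempty)
  open import Data.Fin.Subset.Properties using (_∈?_; nonempty?; Empty-unique; ∣⊥∣≡0; ∣⁅x⁆∣≡1; drop-there)
  open import Data.Vec using ([]; _∷_; tabulate)
  open import Data.Vec.Properties using (lookup∘tabulate; []=⇒lookup; lookup⇒[]=)
  open import Data.Product using (∃; _,_; _×_)
  open import Algebra.Properties.Semiring.Sum +-*-semiring using (sum; sum-replicate-zero)
  open import Relation.Nullary using (Dec; yes; no; does; contradiction)
  open import Relation.Nullary.Decidable using (_×-dec_)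
  open import Relation.Unary using (Pred; Decidable)
  open import Relation.Binary.PropositionalEquality using (_≡_; refl; sym; trans; cong; subst; module ≡-Reasoning)
  open import Function using (_∘_)

  private
    variable
      n c : ℕ

  Empty⇒∣p∣≡0 : {p : Subset n} → Empty p → ∣ p ∣ ≡ 0
  Empty⇒∣p∣≡0 {n} p-empty = trans (cong ∣_∣ (Empty-unique p-empty)) (∣⊥∣≡0 n)

  0<∣p∣⇒Nonempty : (p : Subset n) → 0 < ∣ p ∣ → Nonempty p
  0<∣p∣⇒Nonempty p 0<∣p∣ with nonempty? p
  ... | yes p-nonempty = p-nonempty
  ... | no  p-empty    = contradiction (Empty⇒∣p∣≡0 p-empty) (>⇒≢ 0<∣p∣)

  ∣p∪q∣+∣p∩q∣≡∣p∣+∣q∣ : (p q : Subset n) → ∣ p ∪ q ∣ + ∣ p ∩ q ∣ ≡ ∣ p ∣ + ∣ q ∣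
  ∣p∪q∣+∣p∩q∣≡∣p∣+∣q∣ []            []            = refl
  ∣p∪q∣+∣p∩q∣≡∣p∣+∣q∣ (outside ∷ p) (outside ∷ q) = ∣p∪q∣+∣p∩q∣≡∣p∣+∣q∣ p q
  ∣p∪q∣+∣p∩q∣≡∣p∣+∣q∣ (inside  ∷ p) (outside ∷ q) = cong suc (∣p∪q∣+∣p∩q∣≡∣p∣+∣q∣ p q)
  ∣p∪q∣+∣p∩q∣≡∣p∣+∣q∣ (outside ∷ p) (inside  ∷ q) =
    trans (cong suc (∣p∪q∣+∣p∩q∣≡∣p∣+∣q∣ p q)) (sym (+-suc ∣ p ∣ ∣ q ∣))
  ∣p∪q∣+∣p∩q∣≡∣p∣+∣q∣ (inside  ∷ p) (inside  ∷ q) = cong suc (begin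
    ∣ p ∪ q ∣ + suc ∣ p ∩ q ∣  ≡⟨ +-suc ∣ p ∪ q ∣ ∣ p ∩ q ∣ ⟩
    suc (∣ p ∪ q ∣ + ∣ p ∩ q ∣) ≡⟨ cong suc (∣p∪q∣+∣p∩q∣≡∣p∣+∣q∣ p q) ⟩
    suc (∣ p ∣ + ∣ q ∣)         ≡⟨ +-suc ∣ p ∣ ∣ q ∣ ⟨
    ∣ p ∣ + suc ∣ q ∣           ∎)
    where open ≡-Reasoning

  Empty⇒∣p∪q∣≡∣p∣+∣q∣ : (p q : Subset n) → Empty (p ∩ q) → ∣ p ∪ q ∣ ≡ ∣ p ∣ + ∣ q ∣
  Empty⇒∣p∪q∣≡∣p∣+∣q∣ p q p∩q-empty = begin
    ∣ p ∪ q ∣              ≡⟨ +-identityʳ _ ⟨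
    ∣ p ∪ q ∣ + 0          ≡⟨ cong (∣ p ∪ q ∣ +_) (Empty⇒∣p∣≡0 p∩q-empty) ⟨
    ∣ p ∪ q ∣ + ∣ p ∩ q ∣  ≡⟨ ∣p∪q∣+∣p∩q∣≡∣p∣+∣q∣ p q ⟩
    ∣ p ∣ + ∣ q ∣          ∎
    where open ≡-Reasoning

  ∣p∪⁅x⁆∣≤1+∣p∣ : (p : Subset n) (x : Fin n) → ∣ p ∪ ⁅ x ⁆ ∣ ≤ suc ∣ p ∣
  ∣p∪⁅x⁆∣≤1+∣p∣ p x = begin
    ∣ p ∪ ⁅ x ⁆ ∣                       ≤⟨ m≤m+n _ _ ⟩
    ∣ p ∪ ⁅ x ⁆ ∣ + ∣ p ∩ ⁅ x ⁆ ∣        ≡⟨ ∣p∪q∣+∣p∩q∣≡∣p∣+∣q∣ p ⁅ x ⁆ ⟩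
    ∣ p ∣ + ∣ ⁅ x ⁆ ∣                   ≡⟨ cong (∣ p ∣ +_) (∣⁅x⁆∣≡1 x) ⟩
    ∣ p ∣ + 1                           ≡⟨ +-comm ∣ p ∣ 1 ⟩
    suc ∣ p ∣                           ∎
    where open ≤-Reasoning

  select : ∀ {ℓ} {P : Pred (Fin n) ℓ} → Decidable P → Subset n
  select P? = tabulate λ i → if does (P? i) then inside else outside

  module _ {ℓ} {P : Pred (Fin n) ℓ} (P? : Decidable P) {i : Fin n} where
    ∈-select⁻ : i ∈ select P? → P i
    ∈-select⁻ i∈ with P? i | trans (sym (lookup∘tabulate _ i)) ([]=⇒lookup i∈)
    ... | yes Pi | _ = Pi

    ∈-select⁺ : P i → i ∈ select P?
    ∈-select⁺ Pi = lookup⇒[]= i _ (trans (lookup∘tabulate _ i) (accepted (P? i)))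
      where
      accepted : (Pi? : Dec (P i)) → (if does Pi? then inside else outside) ≡ inside
      accepted (yes _)  = refl
      accepted (no ¬Pi) = contradiction Pi ¬Pi

  fibre : (Fin n → Fin c) → Subset n → Fin c → Subset n
  fibre σ D x = select (λ i → (i ∈? D) ×-dec (σ i ≟ x))

  ∈-fibre⁻ : ∀ (σ : Fin n → Fin c) D {x i} → i ∈ fibre σ D x → i ∈ D × σ i ≡ x
  ∈-fibre⁻ σ D {x} = ∈-select⁻ (λ j → (j ∈? D) ×-dec (σ j ≟ x))

  ∑∣[y≟x]∷p∣≡1+∑∣p∣ : (y : Fin c) (p : Fin c → Subset n) →
    sum (λ x → ∣ (if does (y ≟ x) then inside else outside) ∷ p x ∣) ≡ suc (sum (λ x → ∣ p x ∣))
  ∑∣[y≟x]∷p∣≡1+∑∣p∣ zero    p = refl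
  ∑∣[y≟x]∷p∣≡1+∑∣p∣ (suc y) p =
    trans (cong (∣ p zero ∣ +_) (∑∣[y≟x]∷p∣≡1+∑∣p∣ y (p ∘ suc))) (+-suc ∣ p zero ∣ _)

  ∣D∣≡∑∣fibre∣ : (σ : Fin n → Fin c) (D : Subset n) → ∣ D ∣ ≡ sum (λ x → ∣ fibre σ D x ∣)
  ∣D∣≡∑∣fibre∣ {c = c} σ []    = sym (sum-replicate-zero c)
  ∣D∣≡∑∣fibre∣ σ (outside ∷ D) = ∣D∣≡∑∣fibre∣ (σ ∘ suc) D
  ∣D∣≡∑∣fibre∣ σ (inside  ∷ D) =
    trans (cong suc (∣D∣≡∑∣fibre∣ (σ ∘ suc) D)) (sym (∑∣[y≟x]∷p∣≡1+∑∣p∣ (σ zero) (fibre (σ ∘ suc) D)))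

  ∑≤b*∣S∣ : ∀ {b} (S : Subset c) (f : Fin c → ℕ) → (∀ {x} → x ∉ S → f x ≡ 0) → (∀ x → f x ≤ b) →
            sum f ≤ b * ∣ S ∣
  ∑≤b*∣S∣         []            f f≡0 f≤b = z≤n
  ∑≤b*∣S∣ {b = b} (inside  ∷ S) f f≡0 f≤b = begin
    f zero + sum (f ∘ suc)  ≤⟨ +-mono-≤ (f≤b zero) (∑≤b*∣S∣ S (f ∘ suc) (f≡0 ∘ (_∘ drop-there)) (f≤b ∘ suc)) ⟩
    b + b * ∣ S ∣           ≡⟨ *-suc b ∣ S ∣ ⟨
    b * suc ∣ S ∣           ∎
    where open ≤-Reasoning
  ∑≤b*∣S∣ {b = b} (outside ∷ S) f f≡0 f≤b =
    subst (λ f₀ → f₀ + sum (f ∘ suc) ≤ b * ∣ S ∣) (sym (f≡0 λ ()))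
          (∑≤b*∣S∣ S (f ∘ suc) (f≡0 ∘ (_∘ drop-there)) (f≤b ∘ suc))

  pigeonhole : ∀ {b} (σ : Fin n → Fin c) (D : Subset n) (S : Subset c) → (∀ {i} → i ∈ D → σ i ∈ S) →
               b * ∣ S ∣ < ∣ D ∣ → ∃ λ x → b < ∣ fibre σ D x ∣
  pigeonhole {b = b} σ D S σ[D]⊆S b∣S∣<∣D∣ with any? (λ x → b <? ∣ fibre σ D x ∣)
  ... | yes large = large
  ... | no ¬large = contradiction ∣D∣≤b∣S∣ (<⇒≱ b∣S∣<∣D∣)
    where
    ∣fibre∣≡0 : ∀ {x} → x ∉ S → ∣ fibre σ D x ∣ ≡ 0
    ∣fibre∣≡0 x∉S = Empty⇒∣p∣≡0 λ (i , i∈fibre) → let i∈D , σi≡x = ∈-fibre⁻ σ D i∈fibre in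
                      x∉S (subst (_∈ S) σi≡x (σ[D]⊆S i∈D))

    ∣D∣≤b∣S∣ : ∣ D ∣ ≤ b * ∣ S ∣
    ∣D∣≤b∣S∣ = subst (_≤ b * ∣ S ∣) (sym (∣D∣≡∑∣fibre∣ σ D))
                     (∑≤b*∣S∣ S _ ∣fibre∣≡0 (λ x → ≮⇒≥ (¬large ∘ (x ,_))))

module NearestNeighbours where
  open import Data.Nat using (ℕ; zero; suc; _≤_; z≤n; s≤s; s≤s⁻¹)
  open import Data.Nat.Properties using (≤-trans; ≤-refl; ≤-reflexive; n≤1+n)
  open import Data.Bool using (true; false)
  open import Data.Rational using (ℚ) renaming (_≤_ to _≤ℚ_)
  open import Data.Rational.Properties using (_≤?_; ≤-decTotalOrder)
    renaming (≤-refl to ≤ℚ-refl; ≤-trans to ≤ℚ-trans)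
  open import Data.Fin using (Fin; zero; suc)
  open import Data.Fin.Subset using (Subset; _∈_; ∣_∣)
  open import Data.List using (List; []; _∷_; map; length; filter; tabulate)
  open import Data.List.Base using (allFin)
  open import Data.List.Properties using (map-tabulate; length-tabulate; filter-accept; filter-reject; filter-none)
  open import Data.List.Relation.Unary.All as All using (All; _∷_)
  open import Data.List.Relation.Unary.AllPairs using (_∷_)
  open import Data.List.Relation.Unary.Linked using (tail)
  open import Data.List.Relation.Binary.Permutation.Propositional using (_↭_)
  open import Data.List.Relation.Binary.Permutation.Propositional.Properties using (↭-length; filter-↭)
  open import Data.List.Relation.Unary.Sorted.TotalOrder using (Sorted)
  open import Data.List.Relation.Unary.Sorted.TotalOrder.Properties using (Sorted⇒AllPairs)
  open import Data.List.Sort ≤-decTotalOrder using (sort; sort-↭; sort-↗)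
  open import Relation.Binary.Bundles using (DecTotalOrder)
  open import Relation.Nullary using (yes; no; does; contradiction)
  open import Relation.Unary using (Pred; Decidable)
  open import Relation.Binary.PropositionalEquality using (_≡_; refl; sym; trans; cong; subst)
  open import Function using (_∘_; id)
  open import Defs using (nth1)
  open Counting using (select; ∈-select⁻; ∈-select⁺)

  private
    Sorted≤ : List ℚ → Set
    Sorted≤ = Sorted (DecTotalOrder.totalOrder ≤-decTotalOrder)

    head≤ : ∀ {x xs} → Sorted≤ (x ∷ xs) → All (x ≤ℚ_) xs
    head≤ x∷xs↗ with x≤xs ∷ _ ← Sorted⇒AllPairs (DecTotalOrder.totalOrder ≤-decTotalOrder) x∷xs↗ = x≤xs

  nth1-All : ∀ {ℓ} {P : Pred ℚ ℓ} {xs} m → All P xs → 1 ≤ m → m ≤ length xs → P (nth1 m xs)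
  nth1-All (suc zero)    (px ∷ _)   _ _            = px
  nth1-All (suc (suc m)) (_  ∷ pxs) _ (s≤s m<∣xs∣) = nth1-All (suc m) pxs (s≤s z≤n) m<∣xs∣

  ∣filter[x∷xs]∣≤1+∣filter[xs]∣ : ∀ {ℓ} {P : Pred ℚ ℓ} (P? : Decidable P) x xs →
                                  length (filter P? (x ∷ xs)) ≤ suc (length (filter P? xs))
  ∣filter[x∷xs]∣≤1+∣filter[xs]∣ P? x xs with does (P? x)
  ... | true  = ≤-refl
  ... | false = n≤1+n _

  m≤∣filter[≤nth1]∣ : ∀ {xs} m → Sorted≤ xs → 1 ≤ m → m ≤ length xs → m ≤ length (filter (_≤? nth1 m xs) xs)
  m≤∣filter[≤nth1]∣ {x ∷ xs} (suc zero) _ _ _ rewrite filter-accept (_≤? x) {x} {xs} ≤ℚ-refl = s≤s z≤n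
  m≤∣filter[≤nth1]∣ {x ∷ xs} (suc (suc m)) x∷xs↗ _ (s≤s m<∣xs∣)
    rewrite filter-accept (_≤? nth1 (suc m) xs) {x} {xs} (nth1-All (suc m) (head≤ x∷xs↗) (s≤s z≤n) m<∣xs∣) =
    s≤s (m≤∣filter[≤nth1]∣ (suc m) (tail x∷xs↗) (s≤s z≤n) m<∣xs∣)

  nth1≤ : ∀ {xs r} m → Sorted≤ xs → 1 ≤ m → m ≤ length (filter (_≤? r) xs) → nth1 m xs ≤ℚ r
  nth1≤ {x ∷ xs} {r} (suc zero) x∷xs↗ _ 1≤∣filter∣ with x ≤? r
  ... | yes x≤r = x≤r
  ... | no  x≰r = contradiction (≤-trans 1≤∣filter∣ (≤-reflexive (cong length nothing≤r))) λ ()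
    where
    nothing≤r : filter (_≤? r) (x ∷ xs) ≡ []
    nothing≤r = trans (filter-reject (_≤? r) x≰r)
                      (filter-none (_≤? r) (All.map (λ x≤y y≤r → x≰r (≤ℚ-trans x≤y y≤r)) (head≤ x∷xs↗)))
  nth1≤ {x ∷ xs} {r} (suc (suc m)) x∷xs↗ _ m≤∣filter∣ =
    nth1≤ (suc m) (tail x∷xs↗) (s≤s z≤n)
          (s≤s⁻¹ (≤-trans m≤∣filter∣ (∣filter[x∷xs]∣≤1+∣filter[xs]∣ (_≤? r) x xs)))

  length-filter-tabulate : ∀ {n ℓ} {P : Pred ℚ ℓ} (P? : Decidable P) (f : Fin n → ℚ) →
                           length (filter P? (tabulate f)) ≡ ∣ select (P? ∘ f) ∣
  length-filter-tabulate {zero}  P? f = refl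
  length-filter-tabulate {suc n} P? f with P? (f zero)
  ... | yes _ = cong suc (length-filter-tabulate P? (f ∘ suc))
  ... | no  _ = length-filter-tabulate P? (f ∘ suc)

  module _ {n : ℕ} (d : Fin n → Fin n → ℚ) (i : Fin n) where
    ball : ℚ → Subset n
    ball r = select (λ j → d i j ≤? r)

    ∈-ball⁻ : ∀ {r j} → j ∈ ball r → d i j ≤ℚ r
    ∈-ball⁻ {r} = ∈-select⁻ (λ j → d i j ≤? r)

    ∈-ball⁺ : ∀ {r j} → d i j ≤ℚ r → j ∈ ball r
    ∈-ball⁺ {r} = ∈-select⁺ (λ j → d i j ≤? r)

    -- NR n k q d i is definitionally nearest (ceilDiv (n ∸ q) k).
    nearest : ℕ → ℚ
    nearest m = nth1 m (sort (map (d i) (allFin n)))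

    private
      distances↭ : sort (map (d i) (allFin n)) ↭ tabulate (d i)
      distances↭ = subst (sort (map (d i) (allFin n)) ↭_) (map-tabulate id (d i)) (sort-↭ _)

      ∣filter[≤r]∣≡∣ball∣ : ∀ r → length (filter (_≤? r) (sort (map (d i) (allFin n)))) ≡ ∣ ball r ∣
      ∣filter[≤r]∣≡∣ball∣ r =
        trans (↭-length (filter-↭ (_≤? r) distances↭)) (length-filter-tabulate (_≤? r) (d i))

    m≤∣ball[nearest]∣ : ∀ {m} → 1 ≤ m → m ≤ n → m ≤ ∣ ball (nearest m) ∣
    m≤∣ball[nearest]∣ {m} 1≤m m≤n =
      subst (m ≤_) (∣filter[≤r]∣≡∣ball∣ (nearest m))
            (m≤∣filter[≤nth1]∣ m (sort-↗ _) 1≤m (subst (m ≤_) (sym ∣distances∣≡n) m≤n))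
      where
      ∣distances∣≡n : length (sort (map (d i) (allFin n))) ≡ n
      ∣distances∣≡n = trans (↭-length distances↭) (length-tabulate (d i))

    nearest≤ : ∀ {m r} → 1 ≤ m → m ≤ ∣ ball r ∣ → nearest m ≤ℚ r
    nearest≤ {m} {r} 1≤m m≤∣ball∣ =
      nth1≤ m (sort-↗ _) 1≤m (subst (m ≤_) (sym (∣filter[≤r]∣≡∣ball∣ r)) m≤∣ball∣)

module CeilingDivision where
  open import Data.Nat
  open import Data.Nat.Properties
  open import Data.Nat.DivMod using (m≡m%n+[m/n]*n; m%n<n; m<n*o⇒m/o<n)
  open import Relation.Nullary using (contradiction)
  open import Defs using (ceilDiv)

  a≤⌈a/k⌉*k : ∀ a k .{{_ : NonZero k}} → a ≤ ceilDiv a k * k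
  a≤⌈a/k⌉*k a (suc k) = +-cancelʳ-≤ k a _ (begin
    a + k                                 ≡⟨ m≡m%n+[m/n]*n (a + k) (suc k) ⟩
    (a + k) % suc k + ceilDiv a (suc k) * suc k  ≤⟨ +-monoˡ-≤ _ (s≤s⁻¹ (m%n<n (a + k) (suc k))) ⟩
    k + ceilDiv a (suc k) * suc k         ≡⟨ +-comm k _ ⟩
    ceilDiv a (suc k) * suc k + k         ∎)
    where open ≤-Reasoning

  ⌈a/k⌉-least : ∀ a k {m} .{{_ : NonZero k}} → a ≤ m * k → ceilDiv a k ≤ m
  ⌈a/k⌉-least a (suc k) {m} a≤mk = s≤s⁻¹ (m<n*o⇒m/o<n (begin-strict
    a + k              ≤⟨ +-monoˡ-≤ k a≤mk ⟩
    m * suc k + k      <⟨ +-monoʳ-< (m * suc k) ≤-refl ⟩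
    m * suc k + suc k  ≡⟨ +-comm (m * suc k) (suc k) ⟩
    suc m * suc k      ∎))
    where open ≤-Reasoning

  0<⌈a/k⌉ : ∀ a k .{{_ : NonZero k}} → 0 < a → 0 < ceilDiv a k
  0<⌈a/k⌉ a k 0<a with ceilDiv a k | a≤⌈a/k⌉*k a k
  ... | suc _ | _   = z<s
  ... | zero  | a≤0 = contradiction a≤0 (<⇒≱ 0<a)

  pred⌈a/k⌉*k<a : ∀ a k .{{_ : NonZero k}} → 0 < a → pred (ceilDiv a k) * k < a
  pred⌈a/k⌉*k<a a k 0<a = ≰⇒> λ a≤ → contradiction (⌈a/k⌉-least a k a≤) (<⇒≱ pred[m]<m)
    where
    pred[m]<m : pred (ceilDiv a k) < ceilDiv a k
    pred[m]<m = ≤-reflexive (suc-pred (ceilDiv a k) {{>-nonZero (0<⌈a/k⌉ a k 0<a)}})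

module FairnessRatio where
  open import Data.Nat using (ℕ)
  open import Data.Integer using (+_)
  open import Data.Rational
  open import Data.Rational.Properties
  open import Data.Fin using (Fin)
  open import Data.Fin.Subset using (_∉_)
  open import Data.Fin.Subset.Properties using (_∈?_)
  open import Data.List using ([]; _∷_; map; foldr)
  open import Data.List.Base using (allFin)
  open import Data.List.Membership.Propositional using (_∈_)
  open import Data.List.Membership.Propositional.Properties using (∈-allFin)
  open import Data.List.Relation.Unary.Any using (here; there)
  open import Relation.Nullary using (yes; no; contradiction)
  open import Relation.Binary.PropositionalEquality
  open import Defs using (safeDiv; NR; alpha; Solution; sol)

  safeDiv*y≡x : ∀ x y → 0ℚ < y → safeDiv x y * y ≡ x
  safeDiv*y≡x x y 0<y with y ≟ 0ℚ
  ... | yes y≡0 = contradiction 0<y (<-irrefl (sym y≡0))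
  ... | no  y≢0 = begin
    x * 1/ y * y    ≡⟨ *-assoc x (1/ y) y ⟩
    x * (1/ y * y)  ≡⟨ cong (x *_) (*-inverseˡ y) ⟩
    x * 1ℚ          ≡⟨ *-identityʳ x ⟩
    x               ∎
    where
    open ≡-Reasoning
    instance _ = ≢-nonZero y≢0

  safeDiv≤ : ∀ {x y c} → 0ℚ < y → x ≤ c * y → safeDiv x y ≤ c
  safeDiv≤ {x} {y} {c} 0<y x≤cy =
    *-cancelʳ-≤-pos y {{positive 0<y}} (subst (_≤ c * y) (sym (safeDiv*y≡x x y 0<y)) x≤cy)

  ≤safeDiv : ∀ {x y c} → 0ℚ < y → c * y ≤ x → c ≤ safeDiv x y
  ≤safeDiv {x} {y} {c} 0<y cy≤x =
    *-cancelʳ-≤-pos y {{positive 0<y}} (subst (c * y ≤_) (sym (safeDiv*y≡x x y 0<y)) cy≤x)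

  x+x≡2*x : ∀ x → x + x ≡ + 2 / 1 * x
  x+x≡2*x x = begin
    x + x            ≡⟨ cong₂ _+_ (*-identityˡ x) (*-identityˡ x) ⟨
    1ℚ * x + 1ℚ * x  ≡⟨ *-distribʳ-+ x 1ℚ 1ℚ ⟨
    (1ℚ + 1ℚ) * x    ∎
    where open ≡-Reasoning

  ½*[x+x]≡x : ∀ x → ½ * (x + x) ≡ x
  ½*[x+x]≡x x = begin
    ½ * (x + x)        ≡⟨ cong (½ *_) (x+x≡2*x x) ⟩
    ½ * (+ 2 / 1 * x)  ≡⟨ *-assoc ½ (+ 2 / 1) x ⟨
    1ℚ * x             ≡⟨ *-identityˡ x ⟩
    x                  ∎
    where open ≡-Reasoning

  module _ (n k q : ℕ) (d : Fin n → Fin n → ℚ) where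
    private
      summand : ∀ {x : ℚ} {g : Fin n → ℚ} → x ≡ foldr _⊔_ 0ℚ (map g (allFin n)) → Fin n → ℚ
      summand {g = g} _ = g

    -- The ratio d_{σ(i)i} / NR_q(i) is local to the definition of alpha; it is recovered by unification.
    ratio : Solution n → Fin n → ℚ
    ratio T = summand {x = alpha n k q d T} refl

    ratio-∉ : ∀ {S O σ i} → i ∉ O → ratio (sol S O σ) i ≡ safeDiv (d (σ i) i) (NR n k q d i)
    ratio-∉ {O = O} {i = i} i∉O with i ∈? O
    ... | yes i∈O = contradiction i∈O i∉O
    ... | no  _   = refl

    alpha≤ : ∀ {S O σ b} → 0ℚ ≤ b → (∀ i → i ∉ O → safeDiv (d (σ i) i) (NR n k q d i) ≤ b) →
             alpha n k q d (sol S O σ) ≤ b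
    alpha≤ {S} {O} {σ} {b} 0≤b bound = maximum≤ (allFin n)
      where
      ratio≤ : ∀ i → ratio (sol S O σ) i ≤ b
      ratio≤ i with i ∈? O
      ... | yes _   = 0≤b
      ... | no  i∉O = bound i i∉O

      maximum≤ : ∀ is → foldr _⊔_ 0ℚ (map (ratio (sol S O σ)) is) ≤ b
      maximum≤ []       = 0≤b
      maximum≤ (i ∷ is) = ⊔-lub (ratio≤ i) (maximum≤ is)

    ≤alpha : ∀ {S O σ i} → i ∉ O → safeDiv (d (σ i) i) (NR n k q d i) ≤ alpha n k q d (sol S O σ)
    ≤alpha {S} {O} {σ} {i} i∉O = ≤maximum (∈-allFin i)
      where
      ≤maximum : ∀ {is} → i ∈ is →
                 safeDiv (d (σ i) i) (NR n k q d i) ≤ foldr _⊔_ 0ℚ (map (ratio (sol S O σ)) is)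
      ≤maximum {_ ∷ _}  (here refl)   = ≤-trans (≤-reflexive (sym (ratio-∉ {S} {O} {σ} i∉O))) (p≤p⊔q _ _)
      ≤maximum {j ∷ is} (there i∈is) = ≤-trans (≤maximum i∈is) (p≤q⊔p (ratio (sol S O σ) j) _)

module SubsetArgmax where
  open import Data.Rational using (ℚ; _≤_)
  open import Data.Rational.Properties using (≤-refl; ≤-decTotalOrder)
  open import Relation.Binary.Bundles using (DecTotalOrder)
  open import Data.Fin using (Fin)
  open import Data.Fin.Subset using (Subset; _∈_; Nonempty)
  open import Data.Fin.Subset.Properties using (_∈?_)
  open import Data.List using (filter)
  open import Data.List.Base using (allFin)
  open import Data.List.Membership.Propositional using (lose)
  open import Data.List.Membership.Propositional.Properties using (∈-allFin; ∈-filter⁺)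
  open import Data.List.Relation.Unary.All.Properties using (all-filter)
  open import Data.List.Extrema (DecTotalOrder.totalOrder ≤-decTotalOrder) using (argmax; argmax-all; v≤f[argmax]⁺)
  open import Data.Product using (∃; _×_; _,_)
  open import Data.Sum using (inj₂)

  argmax-∈ : ∀ {n} (f : Fin n → ℚ) (p : Subset n) → Nonempty p → ∃ λ i → i ∈ p × ∀ {j} → j ∈ p → f j ≤ f i
  argmax-∈ {n} f p (i₀ , i₀∈p) = i , argmax-all f i₀∈p (all-filter (_∈? p) (allFin n)) , maximal
    where
    i : Fin n
    i = argmax f i₀ (filter (_∈? p) (allFin n))

    maximal : ∀ {j} → j ∈ p → f j ≤ f i
    maximal j∈p = v≤f[argmax]⁺ i₀ _ (inj₂ (lose (∈-filter⁺ (_∈? p) (∈-allFin _) j∈p) ≤-refl))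

module Approximation where
  open import Data.Nat
  open import Data.Nat.Properties
  open import Data.Integer using (+_)
  open import Data.Rational as ℚ using (ℚ; 0ℚ; ½) renaming (_≤_ to _≤ℚ_; _<_ to _<ℚ_; _+_ to _+ℚ_)
  import Data.Rational.Properties as ℚ
  open import Data.Fin using (Fin)
  open import Data.Fin.Subset using (Subset; _∈_; _∉_; _⊆_; _∪_; _∩_; ∁; ⁅_⁆; ∣_∣; ⊤; ⊥; Empty)
  open import Data.Fin.Subset.Properties
    using (_∈?_; x∈∁p⇒x∉p; ∣∁p∣≡n∸∣p∣; p⊆q⇒∣p∣≤∣q∣; ∣p∣≤n; ∣⊥∣≡0; ∉⊥; ∈⊤; x∈⁅x⁆; p⊆p∪q; q⊆p∪q; x∈p∪q⁻; x∈p∩q⁻)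
  open import Data.Product using (∃; _×_; _,_; proj₁; proj₂)
  open import Data.Sum using (_⊎_; inj₁; inj₂)
  open import Relation.Nullary using (yes; no; contradiction)
  open import Relation.Nullary.Decidable using (_×-dec_)
  open import Relation.Binary.PropositionalEquality using (refl; sym; cong; subst)
  open import Function using (_∘_)
  open import Defs
  open Counting
  open NearestNeighbours using (ball; ∈-ball⁺; ∈-ball⁻; m≤∣ball[nearest]∣; nearest≤)
  open CeilingDivision
  open FairnessRatio
  open SubsetArgmax

  module Instance (n k q : ℕ) .{{_ : NonZero k}} (q<n : q < n)
                  (d : Fin n → Fin n → ℚ) (metric : IsMetric d) (NR>0 : ∀ i → 0ℚ <ℚ NR n k q d i) where
    open IsMetric metric

    private
      NRq : Fin n → ℚ
      NRq = NR n k q d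

      m : ℕ
      m = ceilDiv (n ∸ q) k

      0<n∸q : 0 < n ∸ q
      0<n∸q = m<n⇒0<n∸m q<n

      0<m : 0 < m
      0<m = 0<⌈a/k⌉ (n ∸ q) k 0<n∸q

      m≤∣ball[NR]∣ : ∀ i → m ≤ ∣ ball d i (NRq i) ∣
      m≤∣ball[NR]∣ i = m≤∣ball[nearest]∣ d i 0<m
        (≤-trans (⌈a/k⌉-least (n ∸ q) k (m≤m*n (n ∸ q) k)) (m∸n≤m n q))

      NR≤ : ∀ {i r} → m ≤ ∣ ball d i r ∣ → NRq i ≤ℚ r
      NR≤ = nearest≤ d _ 0<m

      NR≤NR+NR : ∀ i → NRq i ≤ℚ NRq i +ℚ NRq i
      NR≤NR+NR i = ℚ.≤-trans (ℚ.≤-reflexive (sym (ℚ.+-identityʳ (NRq i))))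
                              (ℚ.+-monoʳ-≤ (NRq i) (ℚ.<⇒≤ (NR>0 i)))

    pred[m]*∣S∣<∣∁O∣ : ∀ {S O σ} → Feasible n k q (sol S O σ) → pred m * ∣ S ∣ < ∣ ∁ O ∣
    pred[m]*∣S∣<∣∁O∣ {S} {O} (∣S∣≤k , ∣O∣≤q , _) = begin-strict
      pred m * ∣ S ∣  ≤⟨ *-monoʳ-≤ (pred m) ∣S∣≤k ⟩
      pred m * k      <⟨ pred⌈a/k⌉*k<a (n ∸ q) k 0<n∸q ⟩
      n ∸ q           ≤⟨ ∸-monoʳ-≤ n ∣O∣≤q ⟩
      n ∸ ∣ O ∣       ≡⟨ ∣∁p∣≡n∸∣p∣ O ⟨
      ∣ ∁ O ∣         ∎
      where open ≤-Reasoning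

    large-fibre : ∀ {S O σ} → Feasible n k q (sol S O σ) → ∃ λ c → m ≤ ∣ fibre σ (∁ O) c ∣
    large-fibre {S} {O} {σ} feasible@(_ , _ , σ[V∖O]⊆S)
      with c , pred[m]<∣F∣ ← pigeonhole σ (∁ O) S (σ[V∖O]⊆S _ ∘ x∈∁p⇒x∉p) (pred[m]*∣S∣<∣∁O∣ feasible) =
      c , subst (_≤ ∣ fibre σ (∁ O) c ∣) (suc-pred m {{>-nonZero 0<m}}) pred[m]<∣F∣

    farthest-point : ∀ c {F} → m ≤ ∣ F ∣ → ∃ λ i → i ∈ F × NRq i ≤ℚ d c i +ℚ d c i
    farthest-point c {F} m≤∣F∣
      with i , i∈F , farthest ← argmax-∈ (d c) F (0<∣p∣⇒Nonempty F (≤-trans 0<m m≤∣F∣)) =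
      i , i∈F , NR≤ (≤-trans m≤∣F∣ (p⊆q⇒∣p∣≤∣q∣ F⊆ball))
      where
      F⊆ball : F ⊆ ball d i (d c i +ℚ d c i)
      F⊆ball {j} j∈F = ∈-ball⁺ d i (begin
        d i j           ≤⟨ tri i c j ⟩
        d i c +ℚ d c j  ≤⟨ ℚ.+-mono-≤ (ℚ.≤-reflexive (symm i c)) (farthest j∈F) ⟩
        d c i +ℚ d c i  ∎)
        where open ℚ.≤-Reasoning

    ½≤alpha : ∀ T → Feasible n k q T → ½ ≤ℚ alpha n k q d T
    ½≤alpha (sol S O σ) feasible
      with c , m≤∣F∣ ← large-fibre feasible
      with i , i∈F , NR≤2d ← farthest-point c m≤∣F∣
      with i∈∁O , refl ← ∈-fibre⁻ σ (∁ O) i∈F =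
      ℚ.≤-trans (≤safeDiv (NR>0 i) ½NR≤d) (≤alpha n k q d {S} {O} {σ} (x∈∁p⇒x∉p i∈∁O))
      where
      ½NR≤d : ½ ℚ.* NRq i ≤ℚ d (σ i) i
      ½NR≤d = ℚ.≤-trans (ℚ.*-monoˡ-≤-nonNeg ½ NR≤2d) (ℚ.≤-reflexive (½*[x+x]≡x (d (σ i) i)))

    survivors : Subset n → Fin n → Subset n
    survivors P s = select (λ i → (i ∈? P) ×-dec (NRq i +ℚ NRq i ℚ.<? d i s))

    module _ {P : Subset n} {s i : Fin n} where
      ∈-survivors⁻ : i ∈ survivors P s → i ∈ P × NRq i +ℚ NRq i <ℚ d i s
      ∈-survivors⁻ = ∈-select⁻ (λ j → (j ∈? P) ×-dec (NRq j +ℚ NRq j ℚ.<? d j s))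

      ∈-survivors⁺ : i ∈ P → NRq i +ℚ NRq i <ℚ d i s → i ∈ survivors P s
      ∈-survivors⁺ i∈P far = ∈-select⁺ (λ j → (j ∈? P) ×-dec (NRq j +ℚ NRq j ℚ.<? d j s)) (i∈P , far)

    Covered : Subset n → Subset n → Set
    Covered P S = ∀ {i} → i ∉ P → ∃ λ s → s ∈ S × d i s ≤ℚ NRq i +ℚ NRq i

    -- Invariant of U = ⋃ B(c, NR_q(c)) over the centres c chosen so far.
    Shielded : Subset n → Subset n → Set
    Shielded P U = ∀ {j} → j ∈ U →
      ∃ λ c → d c j ≤ℚ NRq c × ∀ {x} → x ∈ P → NRq c ≤ℚ NRq x × NRq x +ℚ NRq x <ℚ d x c

    private
      variable
        P S P′ S′ U : Subset n

    run-∣S∣≤k : AlgRun n k q d P S P′ S′ → ∣ S ∣ ≤ k → ∣ S′ ∣ ≤ k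
    run-∣S∣≤k (stop _)                       ∣S∣≤k = ∣S∣≤k
    run-∣S∣≤k (step {S = S} s _ _ ∣S∣<k run) _     = run-∣S∣≤k run (≤-trans (∣p∪⁅x⁆∣≤1+∣p∣ S s) ∣S∣<k)

    run-stops : AlgRun n k q d P S P′ S′ → (∀ i → i ∉ P′) ⊎ k ≤ ∣ S′ ∣
    run-stops (stop stopped)     = stopped
    run-stops (step _ _ _ _ run) = run-stops run

    run-covers : AlgRun n k q d P S P′ S′ → Covered P S → Covered P′ S′
    run-covers (stop _)                   covered = covered
    run-covers (step {P} {S} s _ _ _ run) covered = run-covers run covered′
      where
      covered′ : Covered (survivors P s) (S ∪ ⁅ s ⁆)
      covered′ {i} i∉P′ with i ∈? P
      ... | yes i∈P = s , q⊆p∪q S ⁅ s ⁆ (x∈⁅x⁆ s) , ℚ.≮⇒≥ (i∉P′ ∘ ∈-survivors⁺ i∈P)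
      ... | no  i∉P with s′ , s′∈S , close ← covered i∉P = s′ , p⊆p∪q ⁅ s ⁆ s′∈S , close

    shielded-∩-empty : Shielded P U → Empty (U ∩ P)
    shielded-∩-empty {P} {U} shielded (j , j∈U∩P)
      with j∈U , j∈P ← x∈p∩q⁻ U P j∈U∩P
      with c , d[c,j]≤NR[c] , far-from-c ← shielded j∈U
      with NR[c]≤NR[j] , NR+NR<d ← far-from-c j∈P =
      ℚ.<-irrefl refl (ℚ.<-≤-trans NR+NR<d (begin
        d j c           ≡⟨ symm j c ⟩
        d c j           ≤⟨ d[c,j]≤NR[c] ⟩
        NRq c           ≤⟨ NR[c]≤NR[j] ⟩
        NRq j           ≤⟨ NR≤NR+NR j ⟩
        NRq j +ℚ NRq j  ∎))
      where open ℚ.≤-Reasoning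

    shielded-∩-ball-empty : ∀ {s} → Shielded P U → s ∈ P → Empty (U ∩ ball d s (NRq s))
    shielded-∩-ball-empty {P} {U} {s} shielded s∈P (j , j∈U∩B)
      with j∈U , j∈B ← x∈p∩q⁻ U (ball d s (NRq s)) j∈U∩B
      with c , d[c,j]≤NR[c] , far-from-c ← shielded j∈U
      with NR[c]≤NR[s] , NR+NR<d ← far-from-c s∈P =
      ℚ.<-irrefl refl (ℚ.<-≤-trans NR+NR<d (begin
        d s c           ≤⟨ tri s j c ⟩
        d s j +ℚ d j c  ≡⟨ cong (d s j +ℚ_) (symm j c) ⟩
        d s j +ℚ d c j  ≤⟨ ℚ.+-mono-≤ (∈-ball⁻ d s {NRq s} j∈B) (ℚ.≤-trans d[c,j]≤NR[c] NR[c]≤NR[s]) ⟩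
        NRq s +ℚ NRq s  ∎))
      where open ℚ.≤-Reasoning

    shielded-step : ∀ {s} → Shielded P U → (∀ i → i ∈ P → NRq s ≤ℚ NRq i) →
                    Shielded (survivors P s) (U ∪ ball d s (NRq s))
    shielded-step {P} {U} {s} shielded s-minimal {j} j∈U∪B with x∈p∪q⁻ U (ball d s (NRq s)) j∈U∪B
    ... | inj₁ j∈U with c , d[c,j]≤NR[c] , far-from-c ← shielded j∈U =
      c , d[c,j]≤NR[c] , far-from-c ∘ proj₁ ∘ ∈-survivors⁻
    ... | inj₂ j∈B =
      s , ∈-ball⁻ d s {NRq s} j∈B , λ x∈P′ → let x∈P , far = ∈-survivors⁻ x∈P′ in s-minimal _ x∈P , far

    run-packs : AlgRun n k q d P S P′ S′ → m * ∣ S ∣ ≤ ∣ U ∣ → Shielded P U →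
                ∃ λ U′ → m * ∣ S′ ∣ ≤ ∣ U′ ∣ × Shielded P′ U′
    run-packs (stop _) m∣S∣≤∣U∣ shielded = _ , m∣S∣≤∣U∣ , shielded
    run-packs {S = S} {U = U} (step s s∈P s-minimal _ run) m∣S∣≤∣U∣ shielded =
      run-packs run m∣S∪s∣≤∣U∪B∣ (shielded-step shielded s-minimal)
      where
      B : Subset n
      B = ball d s (NRq s)

      m∣S∪s∣≤∣U∪B∣ : m * ∣ S ∪ ⁅ s ⁆ ∣ ≤ ∣ U ∪ B ∣
      m∣S∪s∣≤∣U∪B∣ = begin
        m * ∣ S ∪ ⁅ s ⁆ ∣  ≤⟨ *-monoʳ-≤ m (∣p∪⁅x⁆∣≤1+∣p∣ S s) ⟩
        m * suc ∣ S ∣      ≡⟨ *-suc m ∣ S ∣ ⟩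
        m + m * ∣ S ∣      ≤⟨ +-mono-≤ (m≤∣ball[NR]∣ s) m∣S∣≤∣U∣ ⟩
        ∣ B ∣ + ∣ U ∣      ≡⟨ +-comm ∣ B ∣ ∣ U ∣ ⟩
        ∣ U ∣ + ∣ B ∣      ≡⟨ Empty⇒∣p∪q∣≡∣p∣+∣q∣ U B (shielded-∩-ball-empty shielded s∈P) ⟨
        ∣ U ∪ B ∣          ∎
        where open ≤-Reasoning

    full-packing⇒∣O∣≤q : ∀ {O S U : Subset n} → k ≤ ∣ S ∣ → m * ∣ S ∣ ≤ ∣ U ∣ → Empty (U ∩ O) →
                         ∣ O ∣ ≤ q
    full-packing⇒∣O∣≤q {O} {S} {U} k≤∣S∣ m∣S∣≤∣U∣ U∩O-empty =
      subst (∣ O ∣ ≤_) (m∸[m∸n]≡n (<⇒≤ q<n)) (m+n≤o⇒m≤o∸n ∣ O ∣ (begin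
        ∣ O ∣ + (n ∸ q)  ≤⟨ +-monoʳ-≤ ∣ O ∣ (a≤⌈a/k⌉*k (n ∸ q) k) ⟩
        ∣ O ∣ + m * k    ≤⟨ +-monoʳ-≤ ∣ O ∣ (≤-trans (*-monoʳ-≤ m k≤∣S∣) m∣S∣≤∣U∣) ⟩
        ∣ O ∣ + ∣ U ∣    ≡⟨ +-comm ∣ O ∣ ∣ U ∣ ⟩
        ∣ U ∣ + ∣ O ∣    ≡⟨ Empty⇒∣p∪q∣≡∣p∣+∣q∣ U O U∩O-empty ⟨
        ∣ U ∪ O ∣        ≤⟨ ∣p∣≤n (U ∪ O) ⟩
        n                ∎))
      where open ≤-Reasoning

    output-feasible : ∀ {O S σ} → AlgRun n k q d ⊤ ⊥ O S → (∀ i → i ∉ O → σ i ∈ S) →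
                      Feasible n k q (sol S O σ)
    output-feasible {O} {S} run σ[V∖O]⊆S =
      run-∣S∣≤k run (subst (_≤ k) (sym (∣⊥∣≡0 n)) z≤n) , ∣O∣≤q , σ[V∖O]⊆S
      where
      m*∣⊥∣≤∣⊥∣ : m * ∣ ⊥ {n} ∣ ≤ ∣ ⊥ {n} ∣
      m*∣⊥∣≤∣⊥∣ rewrite ∣⊥∣≡0 n | *-zeroʳ m = z≤n

      ∣O∣≤q : ∣ O ∣ ≤ q
      ∣O∣≤q with run-stops run
      ... | inj₁ nothing-left = subst (_≤ q) (sym (Empty⇒∣p∣≡0 λ (i , i∈O) → nothing-left i i∈O)) z≤n
      ... | inj₂ k≤∣S∣
        with U , m∣S∣≤∣U∣ , shielded ← run-packs {U = ⊥} run m*∣⊥∣≤∣⊥∣ (λ j∈⊥ → contradiction j∈⊥ ∉⊥) =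
        full-packing⇒∣O∣≤q {S = S} k≤∣S∣ m∣S∣≤∣U∣ (shielded-∩-empty shielded)

    alpha≤2 : ∀ {O S σ} → AlgRun n k q d ⊤ ⊥ O S →
              (∀ i → i ∉ O → σ i ∈ S × (∀ h → h ∈ S → d i (σ i) ≤ℚ d i h)) →
              alpha n k q d (sol S O σ) ≤ℚ + 2 ℚ./ 1
    alpha≤2 {O} {S} {σ} run σ-nearest = alpha≤ n k q d {S} {O} {σ} (ℚ.nonNegative⁻¹ (+ 2 ℚ./ 1)) ratio≤2
      where
      ratio≤2 : ∀ i → i ∉ O → safeDiv (d (σ i) i) (NRq i) ≤ℚ + 2 ℚ./ 1
      ratio≤2 i i∉O with s , s∈S , close ← run-covers run (contradiction ∈⊤) i∉O =
        safeDiv≤ (NR>0 i) (begin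
          d (σ i) i            ≡⟨ symm (σ i) i ⟩
          d i (σ i)            ≤⟨ proj₂ (σ-nearest i i∉O) s s∈S ⟩
          d i s                ≤⟨ close ⟩
          NRq i +ℚ NRq i       ≡⟨ x+x≡2*x (NRq i) ⟩
          + 2 ℚ./ 1 ℚ.* NRq i  ∎)
        where open ℚ.≤-Reasoning

open import Defs
open import Data.Nat using (ℕ; _≥_)
import Data.Nat as ℕ
open import Data.Fin using (Fin)
open import Data.Fin.Subset using (Subset; _∈_; _∉_; ⊤; ⊥)
open import Data.Rational using (ℚ; 0ℚ; _≤_; _<_; _*_; _/_; ½)
open import Data.Rational.Properties using (*-monoˡ-≤-nonNeg; module ≤-Reasoning)
open import Data.Integer using (+_)
open import Data.Product using (_×_; _,_; proj₁)

theorem5 : (n k q : ℕ) → n ≥ 1 → k ≥ 1 → q ℕ.< n →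
    (d : Fin n → Fin n → ℚ) → IsMetric d →
    (∀ i → 0ℚ < NR n k q d i) →
    (O S : Subset n) → AlgRun n k q d ⊤ ⊥ O S →
    (σ : Fin n → Fin n) →
    (∀ i → i ∉ O → σ i ∈ S × (∀ h → h ∈ S → d i (σ i) ≤ d i h)) →
    Feasible n k q (sol S O σ) ×
    (∀ (T : Solution n) → Feasible n k q T →
      alpha n k q d (sol S O σ) ≤ (+ 4 / 1) * alpha n k q d T)
theorem5 n k q _ k≥1 q<n d metric NR>0 O S run σ σ-nearest =
  output-feasible run (λ i i∉O → proj₁ (σ-nearest i i∉O)) ,
  λ T T-feasible → begin
    alpha n k q d (sol S O σ)  ≤⟨ alpha≤2 run σ-nearest ⟩
    + 2 / 1                    ≡⟨⟩
    + 4 / 1 * ½                ≤⟨ *-monoˡ-≤-nonNeg (+ 4 / 1) (½≤alpha T T-feasible) ⟩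
    + 4 / 1 * alpha n k q d T  ∎
  where
  open Approximation.Instance n k q {{ℕ.>-nonZero k≥1}} q<n d metric NR>0
  open ≤-Reasoning
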